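{- Let $n\in\{10,14,18,22,26,34,38,46,50,62\}$, write $n=4m+2$, and define the $n\times n$ array $L_n$ with rows and columns indexed by $\{0,\dots,n-1\}$ and entries in $\{0,\dots,n-1\}$ by \[ L_n[i,j]\equiv\begin{cases} i+j+1&\text{if }n-1-m\le i\le n-2\text{ and }j\in\{m,3m+1\},\\ i+j-1&\text{if }n-m\le i<n\text{ and }j\in\{m+1,3m+2\},\\ i+j+m&\text{if }i=n-1-m\text{ and }j\in\{0,m+1,2m+1,3m+2\},\\ i+j-m&\text{if }i=n-1\text{ and }j\in\{0,m,2m+1,3m+1\},\\ i+j&\text{otherwise}, \end{cases}\pmod n. \] Then $L_n$ (a latin square of order $n$) contains a triplex but no transversal.
   Context: A $k$-plex of a latin square of order $n$ is a set of $kn$ cells containing exactly $k$ cells from each row and each column, in which each symbol occurs exactly $k$ times. A transversal is a $1$-plex and a triplex is a $3$-plex. -}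

module Defs where

open import Data.Nat using (ℕ; zero; suc; _+_; _*_; _∸_; _%_; _≤ᵇ_; _≡ᵇ_)
open import Data.Nat.DivMod using (m%n<n)
open import Data.Bool using (Bool; true; false; if_then_else_; _∧_; _∨_)
open import Data.Fin using (Fin; toℕ; fromℕ<) renaming (zero to fzero; suc to fsuc)
open import Data.Fin.Properties using () renaming (_≟_ to _≟ᶠ_)
open import Data.Product using (_×_)
open import Relation.Binary.PropositionalEquality using (_≡_)
open import Relation.Nullary.Decidable using (does)
open import Function.Definitions using (Injective)

∑ : (n : ℕ) → (Fin n → ℕ) → ℕ
∑ zero    f = 0
∑ (suc n) f = f fzero + ∑ n (λ i → f (fsuc i))

Array : ℕ → Set
Array n = Fin n → Fin n → Fin n

IsLatin : (n : ℕ) → Array n → Set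
IsLatin n L = (∀ i → Injective _≡_ _≡_ (L i)) × (∀ j → Injective _≡_ _≡_ (λ i → L i j))

CellSet : ℕ → Set
CellSet n = Fin n → Fin n → Bool

ind : Bool → ℕ
ind true  = 1
ind false = 0

rowCount : (n : ℕ) → CellSet n → Fin n → ℕ
rowCount n S i = ∑ n (λ j → ind (S i j))

colCount : (n : ℕ) → CellSet n → Fin n → ℕ
colCount n S j = ∑ n (λ i → ind (S i j))

cellCount : (n : ℕ) → CellSet n → ℕ
cellCount n S = ∑ n (λ i → rowCount n S i)

symbolCount : (n : ℕ) → Array n → CellSet n → Fin n → ℕ
symbolCount n L S s = ∑ n (λ i → ∑ n (λ j → ind (S i j ∧ does (L i j ≟ᶠ s))))

IsKPlex : (n : ℕ) → ℕ → Array n → CellSet n → Set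
IsKPlex n k L S =
  (cellCount n S ≡ k * n) ×
  (∀ i → rowCount n S i ≡ k) ×
  (∀ j → colCount n S j ≡ k) ×
  (∀ s → symbolCount n L S s ≡ k)

-- The order n = 4m+2 (written 2 + 4m so that it is definitionally a successor).
ord : ℕ → ℕ
ord m = 2 + 4 * m

Lval : (m i j : ℕ) → ℕ
Lval m i j =
  let n = ord m in
  if (((n ∸ 1 ∸ m) ≤ᵇ i) ∧ (i ≤ᵇ (n ∸ 2))) ∧ ((j ≡ᵇ m) ∨ (j ≡ᵇ (3 * m + 1)))
    then (i + j + 1) % n
  else if (((n ∸ m) ≤ᵇ i) ∧ (suc i ≤ᵇ n)) ∧ ((j ≡ᵇ (m + 1)) ∨ (j ≡ᵇ (3 * m + 2)))
    then (i + j + (n ∸ 1)) % n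
  else if ((i ≡ᵇ (n ∸ 1 ∸ m))) ∧ ((j ≡ᵇ 0) ∨ (j ≡ᵇ (m + 1)) ∨ (j ≡ᵇ (2 * m + 1)) ∨ (j ≡ᵇ (3 * m + 2)))
    then (i + j + m) % n
  else if ((i ≡ᵇ (n ∸ 1))) ∧ ((j ≡ᵇ 0) ∨ (j ≡ᵇ m) ∨ (j ≡ᵇ (2 * m + 1)) ∨ (j ≡ᵇ (3 * m + 1)))
    then (i + j + (n ∸ m)) % n
  else (i + j) % n

L : (m : ℕ) → Array (ord m)
L m i j = fromℕ< (m%n<n (Lval m (toℕ i) (toℕ j)) (ord m))

-- Write n = 2h with h = 2m + 1. Every entry of L is i + j + ε⁺(i,j) − ε⁻(i,j) (mod n), where the
-- positive part ε⁺ ≤ m vanishes outside columns m, 3m+1 and row n−1−m, and the negative part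
-- ε⁻ ≤ m vanishes outside columns m+1, 3m+2 and row n−1. Summing over a transversal, the symbols,
-- the row indices and the column indices each add up to T = 0 + 1 + ⋯ + (n−1) ≡ h (mod n), so
-- E⁻ ≡ T + E⁺ (mod n) for the sums E± of ε± along it. A transversal meets each of those columns and
-- rows once, so 0 ≤ E± ≤ m + 2 < h, and E⁻ ≡ h + E⁺ (mod n) is impossible for m ≥ 2.
-- The latin property and the triplexes are checked by computation.

module Submission where

open import Defs
open import Algebra.Properties.CommutativeSemigroup using (x∙yz≈y∙xz)
open import Data.Bool using (Bool; true; false; if_then_else_; _∧_; _∨_)
open import Data.Bool.ListAction using (any)
open import Data.Fin using (Fin; toℕ; inject₁; fromℕ) renaming (zero to fzero; suc to fsuc)
open import Data.Fin.Properties
  using (toℕ-fromℕ<; toℕ-inject₁; toℕ-fromℕ; toℕ<n; toℕ-injective; all?) renaming (_≟_ to _≟ᶠ_)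
open import Data.List using (List; _∷_; []; applyUpTo; findᵇ)
open import Data.List.Membership.Propositional using (_∈_)
open import Data.List.Relation.Unary.All using (All; _∷_; []; lookup)
open import Data.Maybe using (fromMaybe)
open import Data.Nat using (ℕ; zero; suc; _+_; _*_; _∸_; _≤_; _<_; _≤ᵇ_; _≡ᵇ_; _≟_; _≤?_; z≤n; s≤s; NonZero)
open import Data.Nat.DivMod
  using (_%_; %-distribˡ-+; %-distribˡ-*; m%n%n≡m%n; m%n<n; [m+n]%n≡m%n; [m+kn]%n≡m%n; m<n⇒m%n≡m)
open import Data.Nat.Properties hiding (_≟_)
open import Data.Nat.Tactic.RingSolver using (solve-∀)
open import Data.Product using (_×_; ∃; _,_)
open import Data.Vec using (Vec; _∷_; []) renaming (lookup to row)
open import Function using (_∘_)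
open import Function.Definitions using (Injective)
open import Relation.Binary.PropositionalEquality
open import Relation.Nullary using (¬_)
open import Relation.Nullary.Decidable using (Dec; does; True; toWitness; _×-dec_)

open import Algebra.Properties.Semiring.Sum +-*-semiring
  using (sum; sum-syntax; ∑-distrib-+; ∑-comm; *-distribˡ-sum; *-distribʳ-sum; sum-cong-≗; sum-replicate-zero;
         sum-init-last)

∑≡sum : ∀ n (f : Fin n → ℕ) → ∑ n f ≡ sum f
∑≡sum zero    f = refl
∑≡sum (suc n) f = cong (f fzero +_) (∑≡sum n (λ i → f (fsuc i)))

∑∑≡sum∑ : ∀ n (f : Fin n → Fin n → ℕ) → ∑ n (λ i → ∑ n (f i)) ≡ ∑[ i < n ] ∑[ j < n ] f i j
∑∑≡sum∑ n f = trans (∑≡sum n _) (sum-cong-≗ {n} (λ i → ∑≡sum n (f i)))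

sum-mono-≤ : ∀ {n} {f g : Fin n → ℕ} → (∀ i → f i ≤ g i) → sum f ≤ sum g
sum-mono-≤ {zero}  f≤g = z≤n
sum-mono-≤ {suc n} f≤g = +-mono-≤ (f≤g fzero) (sum-mono-≤ (λ i → f≤g (fsuc i)))

sum-pick : ∀ {n} (v : Fin n) (g : Fin n → ℕ) → ∑[ s < n ] (ind (does (v ≟ᶠ s)) * g s) ≡ g v
sum-pick {suc n} fzero    g =
  trans (cong (1 * g fzero +_) (sum-replicate-zero n)) (trans (+-identityʳ _) (*-identityˡ _))
sum-pick {suc n} (fsuc v) g = sum-pick v (λ s → g (fsuc s))

sum-ind-≡ᵇ-≤ : ∀ n a → ∑[ j < n ] ind (toℕ j ≡ᵇ a) ≤ 1
sum-ind-≡ᵇ-≤ zero    a       = z≤n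
sum-ind-≡ᵇ-≤ (suc n) zero    = ≤-reflexive (cong suc (sum-replicate-zero n))
sum-ind-≡ᵇ-≤ (suc n) (suc a) = sum-ind-≡ᵇ-≤ n a

2*sum-toℕ+n≡n*n : ∀ n → 2 * ∑[ i < n ] toℕ i + n ≡ n * n
2*sum-toℕ+n≡n*n zero    = refl
2*sum-toℕ+n≡n*n (suc n) = begin
  2 * ∑[ i < suc n ] toℕ i + suc n
    ≡⟨ cong (λ s → 2 * s + suc n) (sum-init-last {n} toℕ) ⟩
  2 * (∑[ i < n ] toℕ (inject₁ i) + toℕ (fromℕ n)) + suc n
    ≡⟨ cong₂ (λ s t → 2 * (s + t) + suc n) (sum-cong-≗ {n} toℕ-inject₁) (toℕ-fromℕ n) ⟩
  2 * (∑[ i < n ] toℕ i + n) + suc n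
    ≡⟨ regroup (∑[ i < n ] toℕ i) n ⟩
  (2 * ∑[ i < n ] toℕ i + n) + 2 * n + 1
    ≡⟨ cong (λ s → s + 2 * n + 1) (2*sum-toℕ+n≡n*n n) ⟩
  n * n + 2 * n + 1
    ≡⟨ square n ⟩
  suc n * suc n ∎
  where
  open ≡-Reasoning
  regroup : ∀ s n → 2 * (s + n) + suc n ≡ (2 * s + n) + 2 * n + 1
  regroup = solve-∀
  square : ∀ n → n * n + 2 * n + 1 ≡ suc n * suc n
  square = solve-∀

ind-∧ : ∀ a b → ind (a ∧ b) ≡ ind a * ind b
ind-∧ true  b = sym (+-identityʳ (ind b))
ind-∧ false b = refl

ind-∧-≤ˡ : ∀ a b → ind (a ∧ b) ≤ ind a
ind-∧-≤ˡ true  true  = ≤-refl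
ind-∧-≤ˡ true  false = z≤n
ind-∧-≤ˡ false b     = z≤n

ind-∧-≤ʳ : ∀ a b → ind (a ∧ b) ≤ ind b
ind-∧-≤ʳ true  b = ≤-refl
ind-∧-≤ʳ false b = z≤n

ind-∨-≤ : ∀ a b → ind (a ∨ b) ≤ ind a + ind b
ind-∨-≤ true  b = s≤s z≤n
ind-∨-≤ false b = ≤-refl

module _ {d : ℕ} .{{_ : NonZero d}} where

  [m%d+n]%d≡[m+n]%d : ∀ a b → (a % d + b) % d ≡ (a + b) % d
  [m%d+n]%d≡[m+n]%d a b = begin
    (a % d + b) % d         ≡⟨ %-distribˡ-+ (a % d) b d ⟩
    (a % d % d + b % d) % d ≡⟨ cong (λ x → (x + b % d) % d) (m%n%n≡m%n a d) ⟩
    (a % d + b % d) % d     ≡⟨ %-distribˡ-+ a b d ⟨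
    (a + b) % d ∎
    where open ≡-Reasoning

  +-cong-% : ∀ {a b x y} → a % d ≡ b % d → x % d ≡ y % d → (a + x) % d ≡ (b + y) % d
  +-cong-% {a} {b} {x} {y} a≡b x≡y = begin
    (a + x) % d         ≡⟨ %-distribˡ-+ a x d ⟩
    (a % d + x % d) % d ≡⟨ cong₂ (λ u v → (u + v) % d) a≡b x≡y ⟩
    (b % d + y % d) % d ≡⟨ %-distribˡ-+ b y d ⟨
    (b + y) % d ∎
    where open ≡-Reasoning

  *-congˡ-% : ∀ c {a b} → a % d ≡ b % d → (c * a) % d ≡ (c * b) % d
  *-congˡ-% c {a} {b} a≡b = begin
    (c * a) % d           ≡⟨ %-distribˡ-* c a d ⟩
    (c % d * (a % d)) % d ≡⟨ cong (λ u → (c % d * u) % d) a≡b ⟩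
    (c % d * (b % d)) % d ≡⟨ %-distribˡ-* c b d ⟨
    (c * b) % d ∎
    where open ≡-Reasoning

  sum-cong-% : ∀ {n} {f g : Fin n → ℕ} → (∀ i → f i % d ≡ g i % d) → sum f % d ≡ sum g % d
  sum-cong-% {zero}  f≡g = refl
  sum-cong-% {suc n} f≡g = +-cong-% (f≡g fzero) (sum-cong-% (λ i → f≡g (fsuc i)))

module CellSum {n : ℕ} (S : CellSet n) where

  ∑S : (Fin n → Fin n → ℕ) → ℕ
  ∑S f = ∑[ i < n ] ∑[ j < n ] (ind (S i j) * f i j)

  ∑S-mono-≤ : ∀ {f g} → (∀ i j → f i j ≤ g i j) → ∑S f ≤ ∑S g
  ∑S-mono-≤ f≤g = sum-mono-≤ (λ i → sum-mono-≤ (λ j → *-monoʳ-≤ (ind (S i j)) (f≤g i j)))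

  ∑S-cong-% : ∀ {d} .{{_ : NonZero d}} {f g} → (∀ i j → f i j % d ≡ g i j % d) → ∑S f % d ≡ ∑S g % d
  ∑S-cong-% f≡g = sum-cong-% (λ i → sum-cong-% (λ j → *-congˡ-% (ind (S i j)) (f≡g i j)))

  ∑S-+ : ∀ f g → ∑S (λ i j → f i j + g i j) ≡ ∑S f + ∑S g
  ∑S-+ f g = begin
    ∑S (λ i j → f i j + g i j)
      ≡⟨ sum-cong-≗ {n} (λ i → sum-cong-≗ {n} (λ j → *-distribˡ-+ (ind (S i j)) (f i j) (g i j))) ⟩
    ∑[ i < n ] ∑[ j < n ] (ind (S i j) * f i j + ind (S i j) * g i j)
      ≡⟨ sum-cong-≗ {n} (λ i → ∑-distrib-+ {n} _ _) ⟩
    ∑[ i < n ] (∑[ j < n ] (ind (S i j) * f i j) + ∑[ j < n ] (ind (S i j) * g i j))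
      ≡⟨ ∑-distrib-+ {n} _ _ ⟩
    ∑S f + ∑S g ∎
    where open ≡-Reasoning

  ∑S-*ˡ : ∀ c f → ∑S (λ i j → c * f i j) ≡ c * ∑S f
  ∑S-*ˡ c f = begin
    ∑S (λ i j → c * f i j)
      ≡⟨ sum-cong-≗ {n} (λ i → sum-cong-≗ {n} (λ j → x∙yz≈y∙xz *-commutativeSemigroup (ind (S i j)) c (f i j))) ⟩
    ∑[ i < n ] ∑[ j < n ] (c * (ind (S i j) * f i j))
      ≡⟨ sum-cong-≗ {n} (λ i → sym (*-distribˡ-sum {n} c _)) ⟩
    ∑[ i < n ] (c * ∑[ j < n ] (ind (S i j) * f i j))
      ≡⟨ sym (*-distribˡ-sum {n} c _) ⟩
    c * ∑S f ∎
    where open ≡-Reasoning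

  module _ {k : ℕ} where

    ∑S-row : (∀ i → rowCount n S i ≡ k) → ∀ g → ∑S (λ i _ → g i) ≡ k * sum g
    ∑S-row rows g = begin
      ∑[ i < n ] ∑[ j < n ] (ind (S i j) * g i)
        ≡⟨ sum-cong-≗ {n} (λ i → sym (*-distribʳ-sum {n} (g i) _)) ⟩
      ∑[ i < n ] (∑[ j < n ] ind (S i j) * g i)
        ≡⟨ sum-cong-≗ {n} (λ i → cong (_* g i) (trans (sym (∑≡sum n _)) (rows i))) ⟩
      ∑[ i < n ] (k * g i)
        ≡⟨ sym (*-distribˡ-sum {n} k g) ⟩
      k * sum g ∎
      where open ≡-Reasoning

    ∑S-col : (∀ j → colCount n S j ≡ k) → ∀ g → ∑S (λ _ j → g j) ≡ k * sum g
    ∑S-col cols g = begin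
      ∑[ i < n ] ∑[ j < n ] (ind (S i j) * g j)
        ≡⟨ ∑-comm {n} {n} _ ⟩
      ∑[ j < n ] ∑[ i < n ] (ind (S i j) * g j)
        ≡⟨ sum-cong-≗ {n} (λ j → sym (*-distribʳ-sum {n} (g j) _)) ⟩
      ∑[ j < n ] (∑[ i < n ] ind (S i j) * g j)
        ≡⟨ sum-cong-≗ {n} (λ j → cong (_* g j) (trans (sym (∑≡sum n _)) (cols j))) ⟩
      ∑[ j < n ] (k * g j)
        ≡⟨ sym (*-distribˡ-sum {n} k g) ⟩
      k * sum g ∎
      where open ≡-Reasoning

    ∑S-symbol : (A : Array n) → (∀ s → symbolCount n A S s ≡ k) → ∀ g → ∑S (λ i j → g (A i j)) ≡ k * sum g
    ∑S-symbol A symbols g = begin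
      ∑[ i < n ] ∑[ j < n ] (ind (S i j) * g (A i j))
        ≡⟨ sum-cong-≗ {n} (λ i → sum-cong-≗ {n} (λ j → expand i j)) ⟩
      ∑[ i < n ] ∑[ j < n ] ∑[ s < n ] (δ i j s * g s)
        ≡⟨ sum-cong-≗ {n} (λ i → ∑-comm {n} {n} _) ⟩
      ∑[ i < n ] ∑[ s < n ] ∑[ j < n ] (δ i j s * g s)
        ≡⟨ ∑-comm {n} {n} _ ⟩
      ∑[ s < n ] ∑[ i < n ] ∑[ j < n ] (δ i j s * g s)
        ≡⟨ sum-cong-≗ {n} count ⟩
      ∑[ s < n ] (k * g s)
        ≡⟨ sym (*-distribˡ-sum {n} k g) ⟩
      k * sum g ∎
      where
      open ≡-Reasoning
      δ : Fin n → Fin n → Fin n → ℕ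
      δ i j s = ind (S i j ∧ does (A i j ≟ᶠ s))
      expand : ∀ i j → ind (S i j) * g (A i j) ≡ ∑[ s < n ] (δ i j s * g s)
      expand i j = begin
        ind (S i j) * g (A i j)
          ≡⟨ cong (ind (S i j) *_) (sym (sum-pick (A i j) g)) ⟩
        ind (S i j) * ∑[ s < n ] (ind (does (A i j ≟ᶠ s)) * g s)
          ≡⟨ *-distribˡ-sum {n} (ind (S i j)) _ ⟩
        ∑[ s < n ] (ind (S i j) * (ind (does (A i j ≟ᶠ s)) * g s))
          ≡⟨ sum-cong-≗ {n} (λ s → trans (sym (*-assoc (ind (S i j)) (ind (does (A i j ≟ᶠ s))) (g s)))
                                         (cong (_* g s) (sym (ind-∧ (S i j) _)))) ⟩
        ∑[ s < n ] (δ i j s * g s) ∎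
      count : ∀ s → ∑[ i < n ] ∑[ j < n ] (δ i j s * g s) ≡ k * g s
      count s = begin
        ∑[ i < n ] ∑[ j < n ] (δ i j s * g s)
          ≡⟨ sum-cong-≗ {n} (λ i → sym (*-distribʳ-sum {n} (g s) _)) ⟩
        ∑[ i < n ] (∑[ j < n ] δ i j s * g s)
          ≡⟨ sym (*-distribʳ-sum {n} (g s) _) ⟩
        ∑[ i < n ] ∑[ j < n ] δ i j s * g s
          ≡⟨ cong (_* g s) (trans (sym (∑∑≡sum∑ n (λ i j → δ i j s))) (symbols s)) ⟩
        k * g s ∎

  ∑S-lines-≤ : (∀ i → rowCount n S i ≡ 1) → (∀ j → colCount n S j ≡ 1) → ∀ c a b r →
    ∑S (λ i j → ind (toℕ j ≡ᵇ a) + ind (toℕ j ≡ᵇ b) + c * ind (toℕ i ≡ᵇ r)) ≤ 2 + c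
  ∑S-lines-≤ rows cols c a b r = begin
    ∑S (λ i j → δ a j + δ b j + c * δ r i)
      ≡⟨ ∑S-+ (λ _ j → δ a j + δ b j) (λ i _ → c * δ r i) ⟩
    ∑S (λ _ j → δ a j + δ b j) + ∑S (λ i _ → c * δ r i)
      ≡⟨ cong₂ _+_ (∑S-+ (λ _ → δ a) (λ _ → δ b)) (∑S-*ˡ c (λ i _ → δ r i)) ⟩
    ∑S (λ _ → δ a) + ∑S (λ _ → δ b) + c * ∑S (λ i _ → δ r i)
      ≡⟨ cong₂ _+_ (cong₂ _+_ (∑S-col cols (δ a)) (∑S-col cols (δ b))) (cong (c *_) (∑S-row rows (δ r))) ⟩
    1 * sum (δ a) + 1 * sum (δ b) + c * (1 * sum (δ r))
      ≤⟨ +-mono-≤ (+-mono-≤ (at-most-one a) (at-most-one b)) (*-monoʳ-≤ c (at-most-one r)) ⟩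
    1 + 1 + c * 1
      ≡⟨ cong (2 +_) (*-identityʳ c) ⟩
    2 + c ∎
    where
    open ≤-Reasoning
    δ : ℕ → Fin n → ℕ
    δ v x = ind (toℕ x ≡ᵇ v)
    at-most-one : ∀ v → 1 * sum (δ v) ≤ 1
    at-most-one v = ≤-trans (≤-reflexive (*-identityˡ _)) (sum-ind-≡ᵇ-≤ n v)

sum-toℕ-ord : ∀ m → ∑[ i < ord m ] toℕ i ≡ suc (2 * m) + 2 * m * ord m
sum-toℕ-ord m = *-cancelˡ-≡ _ _ 2 (+-cancelʳ-≡ (ord m) _ _ (trans (2*sum-toℕ+n≡n*n (ord m)) (square m)))
  where
  square : ∀ m → (2 + 4 * m) * (2 + 4 * m) ≡ 2 * (suc (2 * m) + 2 * m * (2 + 4 * m)) + (2 + 4 * m)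
  square = solve-∀

module _ (m : ℕ) where

  private
    N = ord m
    T = ∑[ i < N ] toℕ i

  [sum-toℕ+a]%ord : ∀ a → (T + a) % N ≡ (suc (2 * m) + a) % N
  [sum-toℕ+a]%ord a = begin
    (T + a) % N                        ≡⟨ cong (λ t → (t + a) % N) (sum-toℕ-ord m) ⟩
    (suc (2 * m) + 2 * m * N + a) % N  ≡⟨ cong (_% N) (regroup (suc (2 * m)) (2 * m * N) a) ⟩
    (suc (2 * m) + a + 2 * m * N) % N  ≡⟨ [m+kn]%n≡m%n (suc (2 * m) + a) (2 * m) N ⟩
    (suc (2 * m) + a) % N ∎
    where
    open ≡-Reasoning
    regroup : ∀ x y z → x + y + z ≡ x + z + y
    regroup = solve-∀

  [2*sum-toℕ+b]%ord : ∀ b → (T + T + b) % N ≡ b % N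
  [2*sum-toℕ+b]%ord b = begin
    (T + T + b) % N           ≡⟨ cong (λ t → (t + t + b) % N) (sum-toℕ-ord m) ⟩
    (h + 2 * m * N + (h + 2 * m * N) + b) % N ≡⟨ cong (_% N) (regroup m b) ⟩
    (b + (1 + 4 * m) * N) % N ≡⟨ [m+kn]%n≡m%n b (1 + 4 * m) N ⟩
    b % N ∎
    where
    open ≡-Reasoning
    h = suc (2 * m)
    regroup : ∀ m b →
      suc (2 * m) + 2 * m * (2 + 4 * m) + (suc (2 * m) + 2 * m * (2 + 4 * m)) + b ≡ b + (1 + 4 * m) * (2 + 4 * m)
    regroup = solve-∀

m+k≡n⇒m≤n : ∀ {m n} k → m + k ≡ n → m ≤ n
m+k≡n⇒m≤n k refl = m≤m+n _ k

sum-toℕ-shift-mismatch : ∀ m {a b} → 2 ≤ m → a ≤ 2 + m → b ≤ 2 + m →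
  let T = ∑[ i < ord m ] toℕ i in (T + a) % ord m ≢ (T + T + b) % ord m
sum-toℕ-shift-mismatch m@(suc (suc k)) {a} {b} (s≤s (s≤s z≤n)) a≤ b≤ eq =
  <-irrefl refl (≤-trans (m+k≡n⇒m≤n k (gap₁ k)) (≤-trans h≤b b≤))
  where
  gap₁ : ∀ k → suc (2 + (2 + k)) + k ≡ suc (2 * (2 + k))
  gap₁ = solve-∀
  gap₂ : ∀ k → suc (suc (2 * (2 + k)) + (2 + (2 + k))) + k ≡ 2 + 4 * (2 + k)
  gap₂ = solve-∀
  gap₃ : ∀ k → suc (2 + (2 + k)) + (5 + 3 * k) ≡ 2 + 4 * (2 + k)
  gap₃ = solve-∀
  h+a<n : suc (2 * m) + a < ord m
  h+a<n = ≤-trans (s≤s (+-monoʳ-≤ (suc (2 * m)) a≤)) (m+k≡n⇒m≤n k (gap₂ k))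
  b<n : b < ord m
  b<n = ≤-trans (s≤s b≤) (m+k≡n⇒m≤n (5 + 3 * k) (gap₃ k))
  h+a≡b : suc (2 * m) + a ≡ b
  h+a≡b = begin
    suc (2 * m) + a                          ≡⟨ m<n⇒m%n≡m h+a<n ⟨
    (suc (2 * m) + a) % ord m                ≡⟨ [sum-toℕ+a]%ord m a ⟨
    (∑[ i < ord m ] toℕ i + a) % ord m       ≡⟨ eq ⟩
    (∑[ i < ord m ] toℕ i + ∑[ i < ord m ] toℕ i + b) % ord m ≡⟨ [2*sum-toℕ+b]%ord m b ⟩
    b % ord m                                ≡⟨ m<n⇒m%n≡m b<n ⟩
    b ∎
    where open ≡-Reasoning
  h≤b : suc (2 * m) ≤ b
  h≤b = m+k≡n⇒m≤n a h+a≡b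

-- The perturbation of the cyclic square

select : {A : Set} → Bool → Bool → Bool → Bool → A → A → A → A → A → A
select b₁ b₂ b₃ b₄ a₁ a₂ a₃ a₄ a₀ =
  if b₁ then a₁ else if b₂ then a₂ else if b₃ then a₃ else if b₄ then a₄ else a₀

module Perturbation (m : ℕ) where

  N : ℕ
  N = ord m

  upRows downRows upRow downRow : ℕ → Bool
  upRows i = ((N ∸ 1 ∸ m) ≤ᵇ i) ∧ (i ≤ᵇ (N ∸ 2))
  downRows i = ((N ∸ m) ≤ᵇ i) ∧ (suc i ≤ᵇ N)
  upRow i = i ≡ᵇ (N ∸ 1 ∸ m)
  downRow i = i ≡ᵇ (N ∸ 1)

  upCols downCols upRowCols downRowCols : ℕ → Bool
  upCols j = (j ≡ᵇ m) ∨ (j ≡ᵇ (3 * m + 1))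
  downCols j = (j ≡ᵇ (m + 1)) ∨ (j ≡ᵇ (3 * m + 2))
  upRowCols j = (j ≡ᵇ 0) ∨ (j ≡ᵇ (m + 1)) ∨ (j ≡ᵇ (2 * m + 1)) ∨ (j ≡ᵇ (3 * m + 2))
  downRowCols j = (j ≡ᵇ 0) ∨ (j ≡ᵇ m) ∨ (j ≡ᵇ (2 * m + 1)) ∨ (j ≡ᵇ (3 * m + 1))

  -- The four exceptional cases of L, in order: Lval m i j is definitionally `select` over them.
  g₁ g₂ g₃ g₄ : ℕ → ℕ → Bool
  g₁ i j = upRows i ∧ upCols j
  g₂ i j = downRows i ∧ downCols j
  g₃ i j = upRow i ∧ upRowCols j
  g₄ i j = downRow i ∧ downRowCols j

  ε⁺ ε⁻ : ℕ → ℕ → ℕ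
  ε⁺ i j = select (g₁ i j) (g₂ i j) (g₃ i j) (g₄ i j) 1 0 m 0 0
  ε⁻ i j = select (g₁ i j) (g₂ i j) (g₃ i j) (g₄ i j) 0 1 0 m 0

  m≤N : m ≤ N
  m≤N = ≤-trans (m≤n*m m 4) (m≤n+m (4 * m) 2)

  private
    keep : ∀ y → (y % N + 0) % N ≡ y % N
    keep y = trans ([m%d+n]%d≡[m+n]%d y 0) (cong (_% N) (+-identityʳ y))

    wrap : ∀ x c → c ≤ N → ((x + (N ∸ c)) % N + c) % N ≡ (x + 0) % N
    wrap x c c≤N = begin
      ((x + (N ∸ c)) % N + c) % N ≡⟨ [m%d+n]%d≡[m+n]%d (x + (N ∸ c)) c ⟩
      (x + (N ∸ c) + c) % N       ≡⟨ cong (_% N) (trans (+-assoc x (N ∸ c) c) (cong (x +_) (m∸n+n≡m c≤N))) ⟩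
      (x + N) % N                 ≡⟨ [m+n]%n≡m%n x N ⟩
      x % N                       ≡⟨ cong (_% N) (+-identityʳ x) ⟨
      (x + 0) % N ∎
      where open ≡-Reasoning

  select-congruence : ∀ x b₁ b₂ b₃ b₄ →
    (select b₁ b₂ b₃ b₄ ((x + 1) % N) ((x + (N ∸ 1)) % N) ((x + m) % N) ((x + (N ∸ m)) % N) (x % N)
      + select b₁ b₂ b₃ b₄ 0 1 0 m 0) % N
    ≡ (x + select b₁ b₂ b₃ b₄ 1 0 m 0 0) % N
  select-congruence x true  _     _     _     = keep (x + 1)
  select-congruence x false true  _     _     = wrap x 1 (s≤s z≤n)
  select-congruence x false false true  _     = keep (x + m)
  select-congruence x false false false true  = wrap x m m≤N
  select-congruence x false false false false = [m%d+n]%d≡[m+n]%d x 0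

  L-congruence : ∀ (i j : Fin N) →
    (toℕ (L m i j) + ε⁻ (toℕ i) (toℕ j)) % N ≡ (toℕ i + toℕ j + ε⁺ (toℕ i) (toℕ j)) % N
  L-congruence i j = begin
    (toℕ (L m i j) + ε⁻ a b) % N  ≡⟨ cong (λ v → (v + ε⁻ a b) % N) (toℕ-fromℕ< (m%n<n (Lval m a b) N)) ⟩
    (Lval m a b % N + ε⁻ a b) % N ≡⟨ [m%d+n]%d≡[m+n]%d (Lval m a b) (ε⁻ a b) ⟩
    (Lval m a b + ε⁻ a b) % N     ≡⟨ select-congruence (a + b) (g₁ a b) (g₂ a b) (g₃ a b) (g₄ a b) ⟩
    (a + b + ε⁺ a b) % N ∎
    where
    open ≡-Reasoning
    a = toℕ i
    b = toℕ j

  ε⁺-≤ : ∀ i j → ε⁺ i j ≤ ind (j ≡ᵇ m) + ind (j ≡ᵇ (3 * m + 1)) + m * ind (upRow i)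
  ε⁺-≤ i j = ≤-trans (select-≤ (g₁ i j) (g₂ i j) (g₃ i j) (g₄ i j))
    (+-mono-≤ (≤-trans (ind-∧-≤ʳ (upRows i) (upCols j)) (ind-∨-≤ (j ≡ᵇ m) (j ≡ᵇ (3 * m + 1))))
              (*-monoʳ-≤ m (ind-∧-≤ˡ (upRow i) (upRowCols j))))
    where
    select-≤ : ∀ b₁ b₂ b₃ b₄ → select b₁ b₂ b₃ b₄ 1 0 m 0 0 ≤ ind b₁ + m * ind b₃
    select-≤ true  _     _     _     = s≤s z≤n
    select-≤ false true  _     _     = z≤n
    select-≤ false false true  _     = ≤-reflexive (sym (*-identityʳ m))
    select-≤ false false false true  = z≤n
    select-≤ false false false false = z≤n

  ε⁻-≤ : ∀ i j → ε⁻ i j ≤ ind (j ≡ᵇ (m + 1)) + ind (j ≡ᵇ (3 * m + 2)) + m * ind (downRow i)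
  ε⁻-≤ i j = ≤-trans (select-≤ (g₁ i j) (g₂ i j) (g₃ i j) (g₄ i j))
    (+-mono-≤ (≤-trans (ind-∧-≤ʳ (downRows i) (downCols j)) (ind-∨-≤ (j ≡ᵇ (m + 1)) (j ≡ᵇ (3 * m + 2))))
              (*-monoʳ-≤ m (ind-∧-≤ˡ (downRow i) (downRowCols j))))
    where
    select-≤ : ∀ b₁ b₂ b₃ b₄ → select b₁ b₂ b₃ b₄ 0 1 0 m 0 ≤ ind b₂ + m * ind b₄
    select-≤ true  _     _     _     = z≤n
    select-≤ false true  _     _     = s≤s z≤n
    select-≤ false false true  _     = z≤n
    select-≤ false false false true  = ≤-reflexive (sym (*-identityʳ m))
    select-≤ false false false false = z≤n

no-transversal : ∀ m → 2 ≤ m → ¬ (∃ λ S → IsKPlex (ord m) 1 (L m) S)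
no-transversal m 2≤m (S , _ , rows , cols , symbols) =
  sum-toℕ-shift-mismatch m 2≤m
    (≤-trans (∑S-mono-≤ (λ i j → ε⁻-≤ (toℕ i) (toℕ j))) (∑S-lines-≤ rows cols m (m + 1) (3 * m + 2) (N ∸ 1)))
    (≤-trans (∑S-mono-≤ (λ i j → ε⁺-≤ (toℕ i) (toℕ j))) (∑S-lines-≤ rows cols m m (3 * m + 1) (N ∸ 1 ∸ m)))
    congruence
  where
  open Perturbation m
  open CellSum S
  T = ∑[ s < N ] toℕ s
  on : (ℕ → ℕ → ℕ) → Fin N → Fin N → ℕ
  on f i j = f (toℕ i) (toℕ j)
  row-sum : ∑S (λ i _ → toℕ i) ≡ T
  row-sum = trans (∑S-row rows toℕ) (*-identityˡ T)
  col-sum : ∑S (λ _ j → toℕ j) ≡ T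
  col-sum = trans (∑S-col cols toℕ) (*-identityˡ T)
  symbol-sum : ∑S (λ i j → toℕ (L m i j)) ≡ T
  symbol-sum = trans (∑S-symbol (L m) symbols toℕ) (*-identityˡ T)
  congruence : (T + ∑S (on ε⁻)) % N ≡ (T + T + ∑S (on ε⁺)) % N
  congruence = begin
    (T + ∑S (on ε⁻)) % N
      ≡⟨ cong (λ t → (t + ∑S (on ε⁻)) % N) symbol-sum ⟨
    (∑S (λ i j → toℕ (L m i j)) + ∑S (on ε⁻)) % N
      ≡⟨ cong (_% N) (∑S-+ (λ i j → toℕ (L m i j)) (on ε⁻)) ⟨
    ∑S (λ i j → toℕ (L m i j) + on ε⁻ i j) % N
      ≡⟨ ∑S-cong-% {f = λ i j → toℕ (L m i j) + on ε⁻ i j} {g = λ i j → toℕ i + toℕ j + on ε⁺ i j}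
                   L-congruence ⟩
    ∑S (λ i j → toℕ i + toℕ j + on ε⁺ i j) % N
      ≡⟨ cong (_% N) (∑S-+ (λ i j → toℕ i + toℕ j) (on ε⁺)) ⟩
    (∑S (λ i j → toℕ i + toℕ j) + ∑S (on ε⁺)) % N
      ≡⟨ cong (λ t → (t + ∑S (on ε⁺)) % N) (∑S-+ (λ i _ → toℕ i) (λ _ j → toℕ j)) ⟩
    (∑S (λ i _ → toℕ i) + ∑S (λ _ j → toℕ j) + ∑S (on ε⁺)) % N
      ≡⟨ cong₂ (λ t u → (t + u + ∑S (on ε⁺)) % N) row-sum col-sum ⟩
    (T + T + ∑S (on ε⁺)) % N ∎
    where open ≡-Reasoning

injective-via-toℕ : ∀ {n} (f : Fin n → Fin n) (g : ℕ → ℕ) → (∀ x → g (toℕ (f x)) ≡ toℕ x) →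
  Injective _≡_ _≡_ f
injective-via-toℕ f g g∘f≗toℕ {x} {y} fx≡fy =
  toℕ-injective (trans (sym (g∘f≗toℕ x)) (trans (cong (g ∘ toℕ) fx≡fy) (g∘f≗toℕ y)))

entry : ℕ → ℕ → ℕ → ℕ
entry m i j = Lval m i j % ord m

toℕ-L : ∀ m i j → toℕ (L m i j) ≡ entry m (toℕ i) (toℕ j)
toℕ-L m i j = toℕ-fromℕ< (m%n<n (Lval m (toℕ i) (toℕ j)) (ord m))

-- Off the exceptional rows and columns L[i,j] = i + j, so v − i (resp. v − j) is tried first.
rowSolve colSolve : ℕ → ℕ → ℕ → ℕ
rowSolve m i v = fromMaybe 0 (findᵇ (λ j → entry m i j ≡ᵇ v)
  ((v + (ord m ∸ i)) % ord m ∷ 0 ∷ m ∷ m + 1 ∷ 2 * m + 1 ∷ 3 * m + 1 ∷ 3 * m + 2 ∷ []))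
colSolve m j v = fromMaybe 0 (findᵇ (λ i → entry m i j ≡ᵇ v)
  ((v + (ord m ∸ j)) % ord m ∷ applyUpTo (3 * m + 1 +_) (suc m)))

RowsSolved ColsSolved : ℕ → Set
RowsSolved m = ∀ {i} → i < ord m → ∀ {j} → j < ord m → rowSolve m i (entry m i j) ≡ j
ColsSolved m = ∀ {j} → j < ord m → ∀ {i} → i < ord m → colSolve m j (entry m i j) ≡ i

rowsSolved? : ∀ m → Dec (RowsSolved m)
rowsSolved? m = allUpTo? (λ i → allUpTo? (λ j → rowSolve m i (entry m i j) ≟ j) (ord m)) (ord m)

colsSolved? : ∀ m → Dec (ColsSolved m)
colsSolved? m = allUpTo? (λ j → allUpTo? (λ i → colSolve m j (entry m i j) ≟ i) (ord m)) (ord m)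

L-latin : ∀ m → RowsSolved m → ColsSolved m → IsLatin (ord m) (L m)
L-latin m rows cols =
  (λ i → injective-via-toℕ (L m i) (rowSolve m (toℕ i))
           (λ j → trans (cong (rowSolve m (toℕ i)) (toℕ-L m i j)) (rows (toℕ<n i) (toℕ<n j)))) ,
  (λ j → injective-via-toℕ (λ i → L m i j) (colSolve m (toℕ j))
           (λ i → trans (cong (colSolve m (toℕ j)) (toℕ-L m i j)) (cols (toℕ<n j) (toℕ<n i))))

IsKPlex? : ∀ n k A S → Dec (IsKPlex n k A S)
IsKPlex? n k A S =
  (cellCount n S ≟ k * n) ×-dec all? (λ i → rowCount n S i ≟ k) ×-dec
  all? (λ j → colCount n S j ≟ k) ×-dec all? (λ s → symbolCount n A S s ≟ k)

cellsOf : ∀ {n} → Vec (List ℕ) n → CellSet n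
cellsOf rows i j = any (toℕ j ≡ᵇ_) (row rows i)

triplex₁₀ : Vec (List ℕ) (ord 2)
triplex₁₀ =
  (1 ∷ 5 ∷ 7 ∷ []) ∷ (4 ∷ 5 ∷ 6 ∷ []) ∷ (7 ∷ 8 ∷ 9 ∷ []) ∷ (1 ∷ 3 ∷ 9 ∷ []) ∷ (6 ∷ 8 ∷ 9 ∷ []) ∷
  (0 ∷ 3 ∷ 8 ∷ []) ∷ (0 ∷ 2 ∷ 3 ∷ []) ∷ (1 ∷ 2 ∷ 4 ∷ []) ∷ (4 ∷ 5 ∷ 6 ∷ []) ∷ (0 ∷ 2 ∷ 7 ∷ []) ∷ []

triplex₁₄ : Vec (List ℕ) (ord 3)
triplex₁₄ =
  (1 ∷ 5 ∷ 8 ∷ []) ∷ (5 ∷ 6 ∷ 13 ∷ []) ∷ (0 ∷ 7 ∷ 10 ∷ []) ∷ (4 ∷ 7 ∷ 13 ∷ []) ∷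
  (1 ∷ 10 ∷ 11 ∷ []) ∷ (4 ∷ 8 ∷ 12 ∷ []) ∷ (2 ∷ 5 ∷ 12 ∷ []) ∷ (3 ∷ 10 ∷ 11 ∷ []) ∷
  (3 ∷ 4 ∷ 12 ∷ []) ∷ (0 ∷ 7 ∷ 8 ∷ []) ∷ (0 ∷ 2 ∷ 11 ∷ []) ∷ (2 ∷ 3 ∷ 9 ∷ []) ∷ (6 ∷ 9 ∷ 13 ∷ []) ∷
  (1 ∷ 6 ∷ 9 ∷ []) ∷ []

triplex₁₈ : Vec (List ℕ) (ord 4)
triplex₁₈ =
  (4 ∷ 14 ∷ 17 ∷ []) ∷ (3 ∷ 9 ∷ 10 ∷ []) ∷ (0 ∷ 8 ∷ 12 ∷ []) ∷ (4 ∷ 12 ∷ 13 ∷ []) ∷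
  (5 ∷ 14 ∷ 16 ∷ []) ∷ (11 ∷ 15 ∷ 16 ∷ []) ∷ (2 ∷ 3 ∷ 17 ∷ []) ∷ (4 ∷ 6 ∷ 7 ∷ []) ∷
  (11 ∷ 15 ∷ 17 ∷ []) ∷ (1 ∷ 6 ∷ 9 ∷ []) ∷ (1 ∷ 7 ∷ 14 ∷ []) ∷ (1 ∷ 8 ∷ 13 ∷ []) ∷
  (0 ∷ 5 ∷ 13 ∷ []) ∷ (2 ∷ 3 ∷ 11 ∷ []) ∷ (7 ∷ 12 ∷ 16 ∷ []) ∷ (5 ∷ 6 ∷ 8 ∷ []) ∷
  (2 ∷ 10 ∷ 15 ∷ []) ∷ (0 ∷ 9 ∷ 10 ∷ []) ∷ []

triplex₂₂ : Vec (List ℕ) (ord 5)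
triplex₂₂ =
  (7 ∷ 10 ∷ 21 ∷ []) ∷ (5 ∷ 15 ∷ 18 ∷ []) ∷ (0 ∷ 10 ∷ 19 ∷ []) ∷ (1 ∷ 11 ∷ 14 ∷ []) ∷
  (2 ∷ 8 ∷ 17 ∷ []) ∷ (2 ∷ 15 ∷ 17 ∷ []) ∷ (7 ∷ 16 ∷ 20 ∷ []) ∷ (1 ∷ 2 ∷ 8 ∷ []) ∷
  (0 ∷ 1 ∷ 11 ∷ []) ∷ (9 ∷ 14 ∷ 18 ∷ []) ∷ (5 ∷ 6 ∷ 10 ∷ []) ∷ (0 ∷ 4 ∷ 13 ∷ []) ∷
  (13 ∷ 20 ∷ 21 ∷ []) ∷ (3 ∷ 6 ∷ 9 ∷ []) ∷ (4 ∷ 9 ∷ 16 ∷ []) ∷ (12 ∷ 14 ∷ 19 ∷ []) ∷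
  (6 ∷ 11 ∷ 12 ∷ []) ∷ (3 ∷ 7 ∷ 18 ∷ []) ∷ (8 ∷ 13 ∷ 21 ∷ []) ∷ (5 ∷ 16 ∷ 20 ∷ []) ∷
  (3 ∷ 15 ∷ 17 ∷ []) ∷ (4 ∷ 12 ∷ 19 ∷ []) ∷ []

triplex₂₆ : Vec (List ℕ) (ord 6)
triplex₂₆ =
  (5 ∷ 7 ∷ 10 ∷ []) ∷ (8 ∷ 19 ∷ 23 ∷ []) ∷ (10 ∷ 12 ∷ 22 ∷ []) ∷ (5 ∷ 12 ∷ 20 ∷ []) ∷
  (0 ∷ 18 ∷ 25 ∷ []) ∷ (6 ∷ 21 ∷ 22 ∷ []) ∷ (1 ∷ 3 ∷ 17 ∷ []) ∷ (7 ∷ 11 ∷ 23 ∷ []) ∷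
  (8 ∷ 9 ∷ 18 ∷ []) ∷ (4 ∷ 14 ∷ 18 ∷ []) ∷ (0 ∷ 22 ∷ 24 ∷ []) ∷ (2 ∷ 11 ∷ 15 ∷ []) ∷
  (3 ∷ 6 ∷ 13 ∷ []) ∷ (6 ∷ 14 ∷ 23 ∷ []) ∷ (11 ∷ 14 ∷ 24 ∷ []) ∷ (16 ∷ 19 ∷ 25 ∷ []) ∷
  (4 ∷ 5 ∷ 15 ∷ []) ∷ (7 ∷ 12 ∷ 16 ∷ []) ∷ (1 ∷ 4 ∷ 10 ∷ []) ∷ (1 ∷ 2 ∷ 24 ∷ []) ∷
  (15 ∷ 17 ∷ 21 ∷ []) ∷ (8 ∷ 9 ∷ 21 ∷ []) ∷ (16 ∷ 17 ∷ 25 ∷ []) ∷ (2 ∷ 9 ∷ 20 ∷ []) ∷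
  (13 ∷ 19 ∷ 20 ∷ []) ∷ (0 ∷ 3 ∷ 13 ∷ []) ∷ []

triplex₃₄ : Vec (List ℕ) (ord 8)
triplex₃₄ =
  (22 ∷ 27 ∷ 29 ∷ []) ∷ (7 ∷ 22 ∷ 25 ∷ []) ∷ (2 ∷ 11 ∷ 17 ∷ []) ∷ (16 ∷ 27 ∷ 28 ∷ []) ∷
  (21 ∷ 30 ∷ 32 ∷ []) ∷ (5 ∷ 6 ∷ 20 ∷ []) ∷ (6 ∷ 14 ∷ 22 ∷ []) ∷ (8 ∷ 23 ∷ 33 ∷ []) ∷
  (1 ∷ 6 ∷ 30 ∷ []) ∷ (12 ∷ 23 ∷ 28 ∷ []) ∷ (8 ∷ 9 ∷ 33 ∷ []) ∷ (0 ∷ 9 ∷ 24 ∷ []) ∷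
  (10 ∷ 16 ∷ 32 ∷ []) ∷ (3 ∷ 11 ∷ 13 ∷ []) ∷ (1 ∷ 3 ∷ 15 ∷ []) ∷ (2 ∷ 20 ∷ 31 ∷ []) ∷
  (4 ∷ 17 ∷ 18 ∷ []) ∷ (23 ∷ 24 ∷ 25 ∷ []) ∷ (0 ∷ 13 ∷ 18 ∷ []) ∷ (3 ∷ 12 ∷ 24 ∷ []) ∷
  (14 ∷ 19 ∷ 21 ∷ []) ∷ (0 ∷ 19 ∷ 26 ∷ []) ∷ (1 ∷ 10 ∷ 11 ∷ []) ∷ (14 ∷ 25 ∷ 26 ∷ []) ∷
  (26 ∷ 27 ∷ 31 ∷ []) ∷ (4 ∷ 5 ∷ 10 ∷ []) ∷ (2 ∷ 15 ∷ 21 ∷ []) ∷ (12 ∷ 30 ∷ 31 ∷ []) ∷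
  (4 ∷ 16 ∷ 33 ∷ []) ∷ (7 ∷ 9 ∷ 32 ∷ []) ∷ (18 ∷ 28 ∷ 29 ∷ []) ∷ (15 ∷ 19 ∷ 29 ∷ []) ∷
  (7 ∷ 13 ∷ 20 ∷ []) ∷ (5 ∷ 8 ∷ 17 ∷ []) ∷ []

triplex₃₈ : Vec (List ℕ) (ord 9)
triplex₃₈ =
  (21 ∷ 25 ∷ 31 ∷ []) ∷ (28 ∷ 29 ∷ 30 ∷ []) ∷ (3 ∷ 14 ∷ 33 ∷ []) ∷ (9 ∷ 33 ∷ 34 ∷ []) ∷
  (4 ∷ 20 ∷ 23 ∷ []) ∷ (1 ∷ 2 ∷ 11 ∷ []) ∷ (1 ∷ 2 ∷ 4 ∷ []) ∷ (16 ∷ 18 ∷ 29 ∷ []) ∷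
  (14 ∷ 19 ∷ 32 ∷ []) ∷ (7 ∷ 20 ∷ 36 ∷ []) ∷ (0 ∷ 23 ∷ 26 ∷ []) ∷ (6 ∷ 22 ∷ 27 ∷ []) ∷
  (3 ∷ 11 ∷ 12 ∷ []) ∷ (7 ∷ 16 ∷ 17 ∷ []) ∷ (6 ∷ 26 ∷ 35 ∷ []) ∷ (0 ∷ 16 ∷ 36 ∷ []) ∷
  (3 ∷ 24 ∷ 25 ∷ []) ∷ (8 ∷ 21 ∷ 35 ∷ []) ∷ (0 ∷ 2 ∷ 24 ∷ []) ∷ (4 ∷ 24 ∷ 30 ∷ []) ∷
  (1 ∷ 14 ∷ 19 ∷ []) ∷ (7 ∷ 9 ∷ 34 ∷ []) ∷ (21 ∷ 25 ∷ 37 ∷ []) ∷ (5 ∷ 11 ∷ 37 ∷ []) ∷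
  (13 ∷ 15 ∷ 31 ∷ []) ∷ (13 ∷ 22 ∷ 23 ∷ []) ∷ (6 ∷ 9 ∷ 27 ∷ []) ∷ (10 ∷ 29 ∷ 30 ∷ []) ∷
  (10 ∷ 13 ∷ 19 ∷ []) ∷ (12 ∷ 15 ∷ 22 ∷ []) ∷ (5 ∷ 10 ∷ 32 ∷ []) ∷ (18 ∷ 26 ∷ 33 ∷ []) ∷
  (18 ∷ 20 ∷ 32 ∷ []) ∷ (17 ∷ 27 ∷ 37 ∷ []) ∷ (8 ∷ 12 ∷ 17 ∷ []) ∷ (28 ∷ 31 ∷ 35 ∷ []) ∷
  (8 ∷ 28 ∷ 36 ∷ []) ∷ (5 ∷ 15 ∷ 34 ∷ []) ∷ []

triplex₄₆ : Vec (List ℕ) (ord 11)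
triplex₄₆ =
  (24 ∷ 33 ∷ 41 ∷ []) ∷ (2 ∷ 13 ∷ 37 ∷ []) ∷ (0 ∷ 32 ∷ 44 ∷ []) ∷ (21 ∷ 27 ∷ 42 ∷ []) ∷
  (15 ∷ 33 ∷ 40 ∷ []) ∷ (5 ∷ 20 ∷ 28 ∷ []) ∷ (6 ∷ 25 ∷ 26 ∷ []) ∷ (4 ∷ 14 ∷ 43 ∷ []) ∷
  (15 ∷ 27 ∷ 29 ∷ []) ∷ (5 ∷ 17 ∷ 22 ∷ []) ∷ (30 ∷ 31 ∷ 42 ∷ []) ∷ (21 ∷ 28 ∷ 36 ∷ []) ∷
  (1 ∷ 3 ∷ 37 ∷ []) ∷ (2 ∷ 7 ∷ 37 ∷ []) ∷ (3 ∷ 4 ∷ 25 ∷ []) ∷ (7 ∷ 12 ∷ 28 ∷ []) ∷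
  (17 ∷ 32 ∷ 41 ∷ []) ∷ (15 ∷ 29 ∷ 38 ∷ []) ∷ (3 ∷ 6 ∷ 11 ∷ []) ∷ (6 ∷ 16 ∷ 43 ∷ []) ∷
  (10 ∷ 16 ∷ 41 ∷ []) ∷ (31 ∷ 32 ∷ 38 ∷ []) ∷ (1 ∷ 20 ∷ 43 ∷ []) ∷ (2 ∷ 35 ∷ 36 ∷ []) ∷
  (19 ∷ 30 ∷ 39 ∷ []) ∷ (10 ∷ 19 ∷ 21 ∷ []) ∷ (19 ∷ 23 ∷ 26 ∷ []) ∷ (13 ∷ 18 ∷ 23 ∷ []) ∷
  (14 ∷ 27 ∷ 35 ∷ []) ∷ (5 ∷ 8 ∷ 44 ∷ []) ∷ (0 ∷ 8 ∷ 39 ∷ []) ∷ (9 ∷ 16 ∷ 22 ∷ []) ∷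
  (25 ∷ 34 ∷ 40 ∷ []) ∷ (31 ∷ 34 ∷ 42 ∷ []) ∷ (7 ∷ 13 ∷ 40 ∷ []) ∷ (9 ∷ 29 ∷ 39 ∷ []) ∷
  (18 ∷ 20 ∷ 38 ∷ []) ∷ (14 ∷ 36 ∷ 45 ∷ []) ∷ (1 ∷ 24 ∷ 44 ∷ []) ∷ (4 ∷ 23 ∷ 45 ∷ []) ∷
  (8 ∷ 18 ∷ 26 ∷ []) ∷ (10 ∷ 11 ∷ 35 ∷ []) ∷ (9 ∷ 11 ∷ 30 ∷ []) ∷ (17 ∷ 22 ∷ 45 ∷ []) ∷
  (12 ∷ 24 ∷ 33 ∷ []) ∷ (0 ∷ 12 ∷ 34 ∷ []) ∷ []

triplex₅₀ : Vec (List ℕ) (ord 12)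
triplex₅₀ =
  (29 ∷ 32 ∷ 44 ∷ []) ∷ (19 ∷ 20 ∷ 35 ∷ []) ∷ (24 ∷ 25 ∷ 37 ∷ []) ∷ (13 ∷ 19 ∷ 38 ∷ []) ∷
  (5 ∷ 20 ∷ 38 ∷ []) ∷ (21 ∷ 32 ∷ 42 ∷ []) ∷ (0 ∷ 9 ∷ 11 ∷ []) ∷ (12 ∷ 13 ∷ 45 ∷ []) ∷
  (24 ∷ 25 ∷ 34 ∷ []) ∷ (34 ∷ 36 ∷ 40 ∷ []) ∷ (21 ∷ 26 ∷ 45 ∷ []) ∷ (2 ∷ 19 ∷ 35 ∷ []) ∷
  (17 ∷ 28 ∷ 30 ∷ []) ∷ (8 ∷ 46 ∷ 48 ∷ []) ∷ (3 ∷ 29 ∷ 37 ∷ []) ∷ (31 ∷ 43 ∷ 48 ∷ []) ∷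
  (22 ∷ 27 ∷ 46 ∷ []) ∷ (33 ∷ 36 ∷ 40 ∷ []) ∷ (17 ∷ 23 ∷ 43 ∷ []) ∷ (4 ∷ 11 ∷ 34 ∷ []) ∷
  (9 ∷ 31 ∷ 47 ∷ []) ∷ (6 ∷ 10 ∷ 39 ∷ []) ∷ (1 ∷ 6 ∷ 22 ∷ []) ∷ (23 ∷ 31 ∷ 32 ∷ []) ∷
  (2 ∷ 36 ∷ 44 ∷ []) ∷ (10 ∷ 33 ∷ 46 ∷ []) ∷ (1 ∷ 7 ∷ 49 ∷ []) ∷ (7 ∷ 10 ∷ 30 ∷ []) ∷
  (0 ∷ 42 ∷ 44 ∷ []) ∷ (12 ∷ 16 ∷ 26 ∷ []) ∷ (8 ∷ 20 ∷ 39 ∷ []) ∷ (26 ∷ 35 ∷ 41 ∷ []) ∷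
  (16 ∷ 41 ∷ 49 ∷ []) ∷ (3 ∷ 6 ∷ 49 ∷ []) ∷ (17 ∷ 40 ∷ 41 ∷ []) ∷ (15 ∷ 18 ∷ 45 ∷ []) ∷
  (4 ∷ 11 ∷ 30 ∷ []) ∷ (0 ∷ 1 ∷ 38 ∷ []) ∷ (18 ∷ 24 ∷ 47 ∷ []) ∷ (5 ∷ 15 ∷ 25 ∷ []) ∷
  (8 ∷ 18 ∷ 28 ∷ []) ∷ (23 ∷ 27 ∷ 28 ∷ []) ∷ (5 ∷ 13 ∷ 42 ∷ []) ∷ (16 ∷ 22 ∷ 47 ∷ []) ∷
  (4 ∷ 21 ∷ 39 ∷ []) ∷ (7 ∷ 29 ∷ 33 ∷ []) ∷ (14 ∷ 37 ∷ 43 ∷ []) ∷ (2 ∷ 9 ∷ 48 ∷ []) ∷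
  (12 ∷ 14 ∷ 27 ∷ []) ∷ (3 ∷ 14 ∷ 15 ∷ []) ∷ []

triplex₆₂ : Vec (List ℕ) (ord 15)
triplex₆₂ =
  (20 ∷ 27 ∷ 52 ∷ []) ∷ (20 ∷ 31 ∷ 55 ∷ []) ∷ (40 ∷ 51 ∷ 52 ∷ []) ∷ (1 ∷ 5 ∷ 7 ∷ []) ∷
  (22 ∷ 44 ∷ 58 ∷ []) ∷ (34 ∷ 39 ∷ 41 ∷ []) ∷ (26 ∷ 43 ∷ 49 ∷ []) ∷ (14 ∷ 33 ∷ 42 ∷ []) ∷
  (10 ∷ 19 ∷ 60 ∷ []) ∷ (28 ∷ 36 ∷ 44 ∷ []) ∷ (4 ∷ 8 ∷ 61 ∷ []) ∷ (12 ∷ 32 ∷ 41 ∷ []) ∷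
  (0 ∷ 2 ∷ 25 ∷ []) ∷ (9 ∷ 40 ∷ 55 ∷ []) ∷ (7 ∷ 12 ∷ 30 ∷ []) ∷ (35 ∷ 43 ∷ 45 ∷ []) ∷
  (17 ∷ 18 ∷ 56 ∷ []) ∷ (23 ∷ 38 ∷ 44 ∷ []) ∷ (13 ∷ 16 ∷ 46 ∷ []) ∷ (21 ∷ 42 ∷ 50 ∷ []) ∷
  (16 ∷ 31 ∷ 35 ∷ []) ∷ (7 ∷ 9 ∷ 36 ∷ []) ∷ (1 ∷ 45 ∷ 58 ∷ []) ∷ (13 ∷ 51 ∷ 56 ∷ []) ∷
  (4 ∷ 6 ∷ 15 ∷ []) ∷ (10 ∷ 23 ∷ 54 ∷ []) ∷ (10 ∷ 25 ∷ 36 ∷ []) ∷ (19 ∷ 50 ∷ 61 ∷ []) ∷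
  (41 ∷ 48 ∷ 54 ∷ []) ∷ (21 ∷ 39 ∷ 49 ∷ []) ∷ (3 ∷ 9 ∷ 37 ∷ []) ∷ (11 ∷ 14 ∷ 60 ∷ []) ∷
  (30 ∷ 37 ∷ 49 ∷ []) ∷ (5 ∷ 30 ∷ 37 ∷ []) ∷ (3 ∷ 53 ∷ 57 ∷ []) ∷ (19 ∷ 29 ∷ 40 ∷ []) ∷
  (5 ∷ 24 ∷ 61 ∷ []) ∷ (22 ∷ 26 ∷ 55 ∷ []) ∷ (18 ∷ 46 ∷ 48 ∷ []) ∷ (18 ∷ 26 ∷ 27 ∷ []) ∷
  (35 ∷ 42 ∷ 53 ∷ []) ∷ (11 ∷ 17 ∷ 45 ∷ []) ∷ (14 ∷ 47 ∷ 53 ∷ []) ∷ (2 ∷ 29 ∷ 38 ∷ []) ∷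
  (29 ∷ 50 ∷ 56 ∷ []) ∷ (3 ∷ 25 ∷ 28 ∷ []) ∷ (21 ∷ 32 ∷ 60 ∷ []) ∷ (0 ∷ 11 ∷ 39 ∷ []) ∷
  (27 ∷ 31 ∷ 57 ∷ []) ∷ (15 ∷ 28 ∷ 38 ∷ []) ∷ (24 ∷ 54 ∷ 59 ∷ []) ∷ (22 ∷ 47 ∷ 58 ∷ []) ∷
  (8 ∷ 48 ∷ 51 ∷ []) ∷ (6 ∷ 32 ∷ 43 ∷ []) ∷ (12 ∷ 33 ∷ 59 ∷ []) ∷ (2 ∷ 23 ∷ 57 ∷ []) ∷
  (16 ∷ 34 ∷ 46 ∷ []) ∷ (6 ∷ 8 ∷ 59 ∷ []) ∷ (1 ∷ 13 ∷ 33 ∷ []) ∷ (34 ∷ 47 ∷ 52 ∷ []) ∷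
  (4 ∷ 17 ∷ 24 ∷ []) ∷ (0 ∷ 15 ∷ 20 ∷ []) ∷ []

TriplexNoTransversal : ℕ → Set
TriplexNoTransversal m =
  IsLatin (ord m) (L m) × (∃ λ S → IsKPlex (ord m) 3 (L m) S) × ¬ (∃ λ S → IsKPlex (ord m) 1 (L m) S)

certify : ∀ m (triplex : Vec (List ℕ) (ord m)) →
  {_ : True (2 ≤? m)} {_ : True (rowsSolved? m)} {_ : True (colsSolved? m)}
  {_ : True (IsKPlex? (ord m) 3 (L m) (cellsOf triplex))} → TriplexNoTransversal m
certify m triplex {2≤m} {rows} {cols} {isTriplex} =
  L-latin m (toWitness rows) (toWitness cols) ,
  (cellsOf triplex , toWitness isTriplex) ,
  no-transversal m (toWitness 2≤m)

certificates : All TriplexNoTransversal (2 ∷ 3 ∷ 4 ∷ 5 ∷ 6 ∷ 8 ∷ 9 ∷ 11 ∷ 12 ∷ 15 ∷ [])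
certificates =
  certify 2 triplex₁₀ ∷ certify 3 triplex₁₄ ∷ certify 4 triplex₁₈ ∷ certify 5 triplex₂₂ ∷
  certify 6 triplex₂₆ ∷ certify 8 triplex₃₄ ∷ certify 9 triplex₃₈ ∷ certify 11 triplex₄₆ ∷
  certify 12 triplex₅₀ ∷ certify 15 triplex₆₂ ∷ []

theorem4p1 : (m : ℕ) → m ∈ (2 ∷ 3 ∷ 4 ∷ 5 ∷ 6 ∷ 8 ∷ 9 ∷ 11 ∷ 12 ∷ 15 ∷ []) →
    IsLatin (ord m) (L m) ×
    (∃ λ S → IsKPlex (ord m) 3 (L m) S) ×
    (¬ (∃ λ S → IsKPlex (ord m) 1 (L m) S))
theorem4p1 m = lookup certificates
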